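{- For all integers $K \ge 1$ and $N \ge 1$, the procedure described in the context (Algorithm 1) returns exactly $T^* = \min\{T \in \mathbb{N} : E(T,K) \ge N\}$, where $E(T,K) = \sum_{i=1}^{K}\binom{T}{i}$, and it does so in $\mathcal{O}(\log N)$ time and $\mathcal{O}(1)$ space.
   Context: Generalized egg dropping problem: with $K$ identical test items and $N$ floors, $E(T,K) = \sum_{i=1}^{K}\binom{T}{i}$ (with $\binom{T}{i}=0$ for $i>T$) is the maximum number of floors handled by $T$ tests in the worst case, and $T^*$ is the minimum worst-case number of tests. Time counts arithmetic operations and comparisons on integers, each at unit cost; space counts the number of integer variables. Algorithm 1 on input $K \ge 1$, $N \ge 1$: (0) If $N \le 1$ or $K = 1$, return $N$. (1) Set $T_{\text{ideal}} \gets \lceil \log_2(N+1)\rceil$. If $K \ge T_{\text{ideal}}$, return $T_{\text{ideal}}$. (2) Set $L \gets 1$, $R \gets 2^{\lceil T_{\text{ideal}}/K\rceil}$ (one bitwise left shift), $E_{\text{cached}} \gets 0$, $B_{\text{cached}} \gets 1$, $T_{\text{cached}} \gets K$. While $L < R$: set $M_{\text{mid}} \gets \lfloor (L+R)/2\rfloor$, $E_{\text{mid}} \gets 0$, $\text{term} \gets 1$, $T_{\text{mid}} \gets K M_{\text{mid}}$; for $i = 1,\dots,K$: $\text{term} \gets \text{term}\cdot(T_{\text{mid}}-i+1)/i$ (exact integer division), $E_{\text{mid}} \gets E_{\text{mid}} + \text{term}$, and if $E_{\text{mid}} \ge N$ exit the for-loop. Then if $E_{\text{mid}} \ge N$ set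 $R \gets M_{\text{mid}}$; otherwise set $L \gets M_{\text{mid}}+1$, $E_{\text{cached}} \gets E_{\text{mid}}$, $B_{\text{cached}} \gets \text{term}$, $T_{\text{cached}} \gets T_{\text{mid}}$. (3) Set $E \gets E_{\text{cached}}$, $B \gets B_{\text{cached}}$, $T \gets T_{\text{cached}}$. While $E < N$: $E \gets 2E - B + 1$; $B \gets B + (B\cdot K)/(T+1-K)$ (exact integer division); $T \gets T+1$. Return $T$. -}

module Defs where

open import Data.Nat using (ℕ; zero; suc; _+_; _*_; _∸_; _^_; _≤_; _≤ᵇ_; _<ᵇ_; _≡ᵇ_)
open import Data.Nat.DivMod using (_/_)
open import Data.Nat.Combinatorics using (_C_)
open import Data.Nat.Logarithm using (⌈log₂_⌉)
open import Data.Bool using (Bool; true; false; if_then_else_; _∨_)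
open import Data.Maybe using (Maybe; just; nothing)
open import Data.Product using (_×_; _,_)

E : ℕ → ℕ → ℕ
E T zero    = 0
E T (suc k) = E T k + T C suc k

IsMinTests : ℕ → ℕ → ℕ → Set
IsMinTests K N T = (N ≤ E T K) × (∀ T' → N ≤ E T' K → T ≤ T')

-- Algorithm 1, instrumented with an operation counter.
-- Every state consists of a fixed finite number of ℕ variables (O(1) space).
-- Cost counting (unit cost per arithmetic op / comparison) is conservative:
-- each charge below is at least the number of operations on that line.

-- natural-number division (the algorithm only divides by nonzero values,
-- and all divisions are exact)
divN : ℕ → ℕ → ℕ
divN m zero    = 0
divN m (suc d) = m / suc d

ceilDiv : ℕ → ℕ → ℕ
ceilDiv m d = divN (m + d ∸ 1) d

-- inner for-loop of step (2).
-- arguments: remaining iterations r, index i, T_mid, term, E_mid, N, cost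
-- returns (term , E_mid , cost)
inner : ℕ → ℕ → ℕ → ℕ → ℕ → ℕ → ℕ → ℕ × ℕ × ℕ
inner zero    i Tm term Em N c = term , Em , c
inner (suc r) i Tm term Em N c = step (divN (term * (Tm ∸ i + 1)) i)
  where
  -- loop test, ∸, +, *, /, +, comparison, increment of i
  c' : ℕ
  c' = c + 8
  step : ℕ → ℕ × ℕ × ℕ
  step term' = if N ≤ᵇ (Em + term')
               then (term' , Em + term' , c')
               else inner r (suc i) Tm term' (Em + term') N c'

-- binary search of step (2), with fuel (nothing = fuel exhausted).
-- state: L R E_cached B_cached T_cached cost
-- returns (E_cached , B_cached , T_cached , cost)
bsearch : ℕ → (K N L R Ec Bc Tc c : ℕ) → Maybe (ℕ × ℕ × ℕ × ℕ)
bsearch zero    K N L R Ec Bc Tc c = nothing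
bsearch (suc f) K N L R Ec Bc Tc c =
  if L <ᵇ R then body (divN (L + R) 2) else just (Ec , Bc , Tc , c + 1)
  where
  body : ℕ → Maybe (ℕ × ℕ × ℕ × ℕ)
  body M with inner K 1 (K * M) 1 0 N (c + 7)
  -- loop test, +, /2, *, three initialisations
  ... | term , Em , c1 =
    if N ≤ᵇ Em then bsearch f K N L M Ec Bc Tc (c1 + 2)
    else bsearch f K N (M + 1) R Em term (K * M) (c1 + 5)

-- while-loop of step (3), with fuel. Returns (T , cost).
-- E ← 2E − B + 1 is computed as (2E + 1) ∸ B (the integer value is never
-- negative along the run), B ← B + (B·K)/(T+1−K), T ← T+1.
linear : ℕ → (K N E' B T c : ℕ) → Maybe (ℕ × ℕ)
linear zero    K N E' B T c = nothing
linear (suc f) K N E' B T c =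
  if E' <ᵇ N
  then linear f K N ((2 * E' + 1) ∸ B) (B + divN (B * K) (T + 1 ∸ K)) (T + 1) (c + 12)
  else just (T , c + 1)

algorithm : ℕ → (K N : ℕ) → Maybe (ℕ × ℕ)
algorithm f K N =
  if (N ≤ᵇ 1) ∨ (K ≡ᵇ 1) then just (N , 3)
  else step1 ⌈log₂ (N + 1) ⌉
  where
  step1 : ℕ → Maybe (ℕ × ℕ)
  -- computing ⌈log₂(N+1)⌉ is charged Ti + 2 operations (repeated doubling)
  step1 Ti with Ti ≤ᵇ K
  ... | true  = just (Ti , 3 + (Ti + 2) + 1)
  ... | false with bsearch f K N 1 (2 ^ ceilDiv Ti K) 0 1 K (3 + (Ti + 2) + 1 + 10)
  ...   | nothing = nothing
  ...   | just (Ec , Bc , Tc , c2) = linear f K N Ec Bc Tc (c2 + 3)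

-- E satisfies E(T+1, k+1) = E(T, k+1) + E(T, k) + 1, whence E(T, T) = 2^T − 1 and
-- E(T, K) < 2^T for every K: no T < ⌈log₂(N+1)⌉ suffices, and when K ≥ ⌈log₂(N+1)⌉ this
-- bound is attained, which is step (1). Iterating the recurrence gives
-- E(Km, K) ≥ (m+1)^K − 1, so for j = ⌈⌈log₂(N+1)⌉/K⌉ the right end R = 2^j of step (2)
-- has E(KR, K) ≥ N. The binary search keeps E(K(L−1), K) < N ≤ E(KR, K), evaluating each
-- E(KM, K) term by term through C(T, i) = C(T, i−1)(T−i+1)/i, and stops with T* in
-- (T_cached, T_cached + K]; step (3) walks up with E(T+1, K) = 2E(T, K) − C(T, K) + 1 and
-- C(T+1, K) = C(T, K) + C(T, K)K/(T+1−K). Every division is exact because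
-- C(n, k)(n − k) = C(n, k+1)(k+1). The search takes j rounds of O(K) operations and the walk
-- at most K steps; as jK ≤ ⌈log₂(N+1)⌉ + K and K < ⌈log₂(N+1)⌉, both are O(log N).
{-# OPTIONS --safe #-}
module Submission where

open import Defs
open import Data.Bool using (true; false)
open import Data.Empty using (⊥-elim)
open import Data.Maybe using (Maybe; just)
open import Data.Maybe.Relation.Unary.Any as Any using (Any; just)
open import Data.Nat
open import Data.Nat.Properties
open import Data.Nat.DivMod
open import Data.Nat.Divisibility using (n∣m*n)
open import Data.Nat.Combinatorics using (_C_; nCk+nC[k+1]≡[n+1]C[k+1]; nC1≡n)
open import Data.Nat.Combinatorics.Specification using (k>n⇒nCk≡0)
open import Data.Nat.Logarithm using (⌈log₂_⌉; ⌈log₂⌉-mono-≤; ⌈log₂2^n⌉≡n)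
open import Data.Nat.Logarithm.Core using (⌈log2⌉)
open import Data.Nat.Tactic.RingSolver using (solve-∀)
open import Data.Product using (_×_; _,_; ∃-syntax)
open import Data.Sum using (_⊎_; inj₁; inj₂)
open import Induction.WellFounded using (Acc; acc)
open import Relation.Nullary using (¬_)
open import Relation.Nullary.Decidable using (yes; no)
open import Relation.Nullary.Reflects using (ofʸ; ofⁿ)
open import Relation.Binary.PropositionalEquality

-- Binomial coefficients

n≤k⇒nCk*[n∸k]≡nC[1+k]*[1+k] : ∀ {n k} → n ≤ k → (n C k) * (n ∸ k) ≡ (n C suc k) * suc k
n≤k⇒nCk*[n∸k]≡nC[1+k]*[1+k] {n} {k} n≤k = begin
  (n C k) * (n ∸ k)     ≡⟨ cong ((n C k) *_) (m≤n⇒m∸n≡0 n≤k) ⟩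
  (n C k) * 0           ≡⟨ *-zeroʳ (n C k) ⟩
  0                     ≡⟨ cong (_* suc k) (k>n⇒nCk≡0 (s≤s n≤k)) ⟨
  (n C suc k) * suc k   ∎
  where open ≡-Reasoning

nCk*[n∸k]≡nC[1+k]*[1+k] : ∀ n k → (n C k) * (n ∸ k) ≡ (n C suc k) * suc k
nCk*[n∸k]≡nC[1+k]*[1+k] zero    k       = n≤k⇒nCk*[n∸k]≡nC[1+k]*[1+k] {k = k} z≤n
nCk*[n∸k]≡nC[1+k]*[1+k] (suc n) zero    = begin
  1 * suc n          ≡⟨ *-comm 1 (suc n) ⟩
  suc n * 1          ≡⟨ cong (_* 1) (nC1≡n (suc n)) ⟨
  (suc n C 1) * 1    ∎
  where open ≡-Reasoning
nCk*[n∸k]≡nC[1+k]*[1+k] (suc n) (suc k) with k <? n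
... | no k≮n = n≤k⇒nCk*[n∸k]≡nC[1+k]*[1+k] {suc n} {suc k} (s≤s (≮⇒≥ k≮n))
... | yes k<n = begin
  (suc n C suc k) * (n ∸ k)
    ≡⟨ cong (_* (n ∸ k)) (nCk+nC[k+1]≡[n+1]C[k+1] n k) ⟨
  (a + b) * (n ∸ k)
    ≡⟨ *-distribʳ-+ (n ∸ k) a b ⟩
  a * (n ∸ k) + b * (n ∸ k)
    ≡⟨ cong₂ _+_ (nCk*[n∸k]≡nC[1+k]*[1+k] n k) (cong (b *_) (+-∸-assoc 1 k<n)) ⟩
  b * suc k + b * suc (n ∸ suc k)
    ≡⟨ cong (λ x → b * suc k + x) (*-suc b (n ∸ suc k)) ⟩
  b * suc k + (b + b * (n ∸ suc k))
    ≡⟨ cong (λ x → b * suc k + (b + x)) (nCk*[n∸k]≡nC[1+k]*[1+k] n (suc k)) ⟩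
  b * suc k + (b + c * suc (suc k))
    ≡⟨ regroup k b c ⟩
  (b + c) * suc (suc k)
    ≡⟨ cong (_* suc (suc k)) (nCk+nC[k+1]≡[n+1]C[k+1] n (suc k)) ⟩
  (suc n C suc (suc k)) * suc (suc k) ∎
  where
  open ≡-Reasoning
  a b c : ℕ
  a = n C k
  b = n C suc k
  c = n C suc (suc k)
  regroup : ∀ k b c → b * suc k + (b + c * suc (suc k)) ≡ (b + c) * suc (suc k)
  regroup = solve-∀

nC[1+k]-from-nCk : ∀ {n k} → k < n → divN ((n C k) * (n ∸ suc k + 1)) (suc k) ≡ n C suc k
nC[1+k]-from-nCk {n} {k} k<n = begin
  (n C k) * (n ∸ suc k + 1) / suc k   ≡⟨ cong (λ x → (n C k) * x / suc k) n∸[1+k]+1≡n∸k ⟩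
  (n C k) * (n ∸ k) / suc k           ≡⟨ cong (_/ suc k) (nCk*[n∸k]≡nC[1+k]*[1+k] n k) ⟩
  (n C suc k) * suc k / suc k         ≡⟨ m*n/n≡m (n C suc k) (suc k) ⟩
  n C suc k                           ∎
  where
  open ≡-Reasoning
  n∸[1+k]+1≡n∸k : n ∸ suc k + 1 ≡ n ∸ k
  n∸[1+k]+1≡n∸k = trans (+-comm (n ∸ suc k) 1) (sym (+-∸-assoc 1 k<n))

[n+1]C[1+k]-from-nC[1+k] : ∀ {n k} → k < n →
  n C suc k + divN ((n C suc k) * suc k) (n + 1 ∸ suc k) ≡ (n + 1) C suc k
[n+1]C[1+k]-from-nC[1+k] {n} {k} k<n = begin
  n C suc k + divN ((n C suc k) * suc k) (n + 1 ∸ suc k)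
    ≡⟨ cong (λ d → n C suc k + divN ((n C suc k) * suc k) d) n+1∸[1+k]≡1+[n∸[1+k]] ⟩
  n C suc k + (n C suc k) * suc k / suc (n ∸ suc k)
    ≡⟨ cong (λ x → n C suc k + x / suc (n ∸ suc k)) (nCk*[n∸k]≡nC[1+k]*[1+k] n k) ⟨
  n C suc k + (n C k) * (n ∸ k) / suc (n ∸ suc k)
    ≡⟨ cong (λ x → n C suc k + (n C k) * x / suc (n ∸ suc k)) (+-∸-assoc 1 k<n) ⟩
  n C suc k + (n C k) * suc (n ∸ suc k) / suc (n ∸ suc k)
    ≡⟨ cong (n C suc k +_) (m*n/n≡m (n C k) (suc (n ∸ suc k))) ⟩
  n C suc k + n C k
    ≡⟨ +-comm (n C suc k) (n C k) ⟩
  n C k + n C suc k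
    ≡⟨ nCk+nC[k+1]≡[n+1]C[k+1] n k ⟩
  suc n C suc k
    ≡⟨ cong (_C suc k) (+-comm 1 n) ⟩
  (n + 1) C suc k ∎
  where
  open ≡-Reasoning
  n+1∸[1+k]≡1+[n∸[1+k]] : n + 1 ∸ suc k ≡ suc (n ∸ suc k)
  n+1∸[1+k]≡1+[n∸[1+k]] = trans (cong (_∸ suc k) (+-comm n 1)) (+-∸-assoc 1 k<n)

-- The function E

E-pascal : ∀ T k → E (suc T) (suc k) ≡ E T (suc k) + suc (E T k)
E-pascal T zero    = begin
  suc T C 1               ≡⟨ nCk+nC[k+1]≡[n+1]C[k+1] T 0 ⟨
  1 + T C 1               ≡⟨ +-comm 1 (T C 1) ⟩
  T C 1 + 1               ∎
  where open ≡-Reasoning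
E-pascal T (suc k) = begin
  E (suc T) (suc k) + suc T C suc (suc k)
    ≡⟨ cong₂ _+_ (E-pascal T k) (sym (nCk+nC[k+1]≡[n+1]C[k+1] T (suc k))) ⟩
  (E T k + T C suc k) + suc (E T k) + (T C suc k + T C suc (suc k))
    ≡⟨ regroup (E T k) (T C suc k) (T C suc (suc k)) ⟩
  (E T k + T C suc k + T C suc (suc k)) + suc (E T k + T C suc k) ∎
  where
  open ≡-Reasoning
  regroup : ∀ a b c → (a + b) + suc a + (b + c) ≡ (a + b + c) + suc (a + b)
  regroup = solve-∀

E-doubling : ∀ T k → E (suc T) k + T C k ≡ 2 * E T k + 1
E-doubling T zero    = refl
E-doubling T (suc k) = begin
  E (suc T) (suc k) + T C suc k                     ≡⟨ cong (_+ T C suc k) (E-pascal T k) ⟩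
  (E T k + T C suc k) + suc (E T k) + T C suc k     ≡⟨ regroup (E T k) (T C suc k) ⟩
  2 * (E T k + T C suc k) + 1                       ∎
  where
  open ≡-Reasoning
  regroup : ∀ a b → (a + b) + suc a + b ≡ 2 * (a + b) + 1
  regroup = solve-∀

E[T+1]-from-E[T] : ∀ T k → (2 * E T k + 1) ∸ T C k ≡ E (T + 1) k
E[T+1]-from-E[T] T k = begin
  (2 * E T k + 1) ∸ T C k               ≡⟨ cong (_∸ T C k) (E-doubling T k) ⟨
  E (suc T) k + T C k ∸ T C k           ≡⟨ m+n∸n≡m (E (suc T) k) (T C k) ⟩
  E (suc T) k                           ≡⟨ cong (λ T′ → E T′ k) (+-comm 1 T) ⟩
  E (T + 1) k                           ∎
  where open ≡-Reasoning

E-monoʳ-≤ : ∀ T {k k′} → k ≤ k′ → E T k ≤ E T k′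
E-monoʳ-≤ T k≤k′ = go (≤⇒≤′ k≤k′)
  where
  go : ∀ {k k′} → k ≤′ k′ → E T k ≤ E T k′
  go ≤′-refl       = ≤-refl
  go (≤′-step k≤k′) = ≤-trans (go k≤k′) (m≤m+n _ _)

E[T,k]≤E[1+T,k] : ∀ T k → E T k ≤ E (suc T) k
E[T,k]≤E[1+T,k] T zero    = z≤n
E[T,k]≤E[1+T,k] T (suc k) = subst (E T (suc k) ≤_) (sym (E-pascal T k)) (m≤m+n _ _)

E-monoˡ-≤ : ∀ {T T′} k → T ≤ T′ → E T k ≤ E T′ k
E-monoˡ-≤ k T≤T′ = go (≤⇒≤′ T≤T′)
  where
  go : ∀ {T T′} → T ≤′ T′ → E T k ≤ E T′ k
  go ≤′-refl                = ≤-refl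
  go (≤′-step {T′} T≤T′)    = ≤-trans (go T≤T′) (E[T,k]≤E[1+T,k] T′ k)

E-cancelˡ-< : ∀ {T T′} k → E T k < E T′ k → T < T′
E-cancelˡ-< k E<E = ≰⇒> (λ T′≤T → <⇒≱ E<E (E-monoˡ-≤ k T′≤T))

E-zeroˡ : ∀ k → E 0 k ≡ 0
E-zeroˡ zero    = refl
E-zeroˡ (suc k) = cong (_+ 0) (E-zeroˡ k)

1+E[T,T]≡2^T : ∀ T → suc (E T T) ≡ 2 ^ T
1+E[T,T]≡2^T zero    = refl
1+E[T,T]≡2^T (suc T) = begin
  suc (E (suc T) (suc T))                  ≡⟨ cong suc (E-pascal T T) ⟩
  suc (E T T + T C suc T + suc (E T T))    ≡⟨ cong (λ x → suc (E T T + x + suc (E T T))) (k>n⇒nCk≡0 (n<1+n T)) ⟩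
  suc (E T T + 0 + suc (E T T))            ≡⟨ regroup (E T T) ⟩
  2 * suc (E T T)                          ≡⟨ cong (2 *_) (1+E[T,T]≡2^T T) ⟩
  2 * 2 ^ T                                ∎
  where
  open ≡-Reasoning
  regroup : ∀ a → suc (a + 0 + suc a) ≡ 2 * suc a
  regroup = solve-∀

E<2^T : ∀ T k → E T k < 2 ^ T
E<2^T zero    k       = subst (_< 1) (sym (E-zeroˡ k)) z<s
E<2^T (suc T) zero    = m^n>0 2 (suc T)
E<2^T (suc T) (suc k) = begin
  suc (E (suc T) (suc k))            ≡⟨ cong suc (E-pascal T k) ⟩
  suc (E T (suc k)) + suc (E T k)    ≤⟨ +-mono-≤ (E<2^T T (suc k)) (E<2^T T k) ⟩
  2 ^ T + 2 ^ T                      ≡⟨ cong (2 ^ T +_) (+-identityʳ (2 ^ T)) ⟨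
  2 ^ suc T                          ∎
  where open ≤-Reasoning

E-shift : ∀ T m k → E T (suc k) + m * suc (E T k) ≤ E (T + m) (suc k)
E-shift T zero    k = begin
  E T (suc k) + 0       ≡⟨ +-identityʳ (E T (suc k)) ⟩
  E T (suc k)           ≡⟨ cong (λ T′ → E T′ (suc k)) (+-identityʳ T) ⟨
  E (T + 0) (suc k)     ∎
  where open ≤-Reasoning
E-shift T (suc m) k = begin
  E T (suc k) + suc m * suc (E T k)                   ≡⟨ regroup (E T (suc k)) m (suc (E T k)) ⟩
  (E T (suc k) + m * suc (E T k)) + suc (E T k)       ≤⟨ +-mono-≤ (E-shift T m k) (s≤s (E-monoˡ-≤ k (m≤m+n T m))) ⟩
  E (T + m) (suc k) + suc (E (T + m) k)               ≡⟨ E-pascal (T + m) k ⟨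
  E (suc (T + m)) (suc k)                             ≡⟨ cong (λ T′ → E T′ (suc k)) (+-suc T m) ⟨
  E (T + suc m) (suc k)                               ∎
  where
  open ≤-Reasoning
  regroup : ∀ a m b → a + suc m * b ≡ (a + m * b) + b
  regroup = solve-∀

[1+m]^k≤1+E[k*m,k] : ∀ k m → suc m ^ k ≤ suc (E (k * m) k)
[1+m]^k≤1+E[k*m,k] zero    m = ≤-refl
[1+m]^k≤1+E[k*m,k] (suc k) m = begin
  suc m * suc m ^ k                                  ≤⟨ *-monoʳ-≤ (suc m) ([1+m]^k≤1+E[k*m,k] k m) ⟩
  suc m * suc (E (k * m) k)                          ≡⟨ regroup m (E (k * m) k) ⟩
  suc (E (k * m) k + m * suc (E (k * m) k))          ≤⟨ s≤s (+-monoˡ-≤ _ (E-monoʳ-≤ (k * m) (n≤1+n k))) ⟩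
  suc (E (k * m) (suc k) + m * suc (E (k * m) k))    ≤⟨ s≤s (E-shift (k * m) m k) ⟩
  suc (E (k * m + m) (suc k))                        ≡⟨ cong (λ T → suc (E T (suc k))) (+-comm (k * m) m) ⟩
  suc (E (suc k * m) (suc k))                        ∎
  where
  open ≤-Reasoning
  regroup : ∀ m a → suc m * suc a ≡ suc (a + m * suc a)
  regroup = solve-∀

-- Base-2 logarithm and ceiling division

n≤2^⌈log₂n⌉ : ∀ n → n ≤ 2 ^ ⌈log₂ n ⌉
n≤2^⌈log₂n⌉ n = go n _
  where
  go : ∀ n (rec : Acc _<_ n) → n ≤ 2 ^ ⌈log2⌉ n rec
  go 0             _        = z≤n
  go 1             _        = ≤-refl
  go n@(suc (suc n-2)) (acc rs) = begin
    n                     ≡⟨ ⌊n/2⌋+⌈n/2⌉≡n n ⟨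
    ⌊ n /2⌋ + ⌈ n /2⌉      ≤⟨ +-monoˡ-≤ ⌈ n /2⌉ (⌊n/2⌋≤⌈n/2⌉ n) ⟩
    ⌈ n /2⌉ + ⌈ n /2⌉      ≤⟨ +-mono-≤ ih ih ⟩
    2^ℓ + 2^ℓ              ≡⟨ cong (2^ℓ +_) (+-identityʳ 2^ℓ) ⟨
    2 * 2^ℓ                ∎
    where
    open ≤-Reasoning
    2^ℓ : ℕ
    2^ℓ = 2 ^ ⌈log2⌉ ⌈ n /2⌉ (rs (⌈n/2⌉<n n-2))
    ih : ⌈ n /2⌉ ≤ 2^ℓ
    ih = go ⌈ n /2⌉ (rs (⌈n/2⌉<n n-2))

n≤2^k⇒⌈log₂n⌉≤k : ∀ {n} k → n ≤ 2 ^ k → ⌈log₂ n ⌉ ≤ k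
n≤2^k⇒⌈log₂n⌉≤k k n≤2^k = subst (_ ≤_) (⌈log₂2^n⌉≡n k) (⌈log₂⌉-mono-≤ n≤2^k)

⌈log₂[n+1]⌉≤⌈log₂n⌉+1 : ∀ {n} → 1 ≤ n → ⌈log₂ (n + 1) ⌉ ≤ ⌈log₂ n ⌉ + 1
⌈log₂[n+1]⌉≤⌈log₂n⌉+1 {n} 1≤n = n≤2^k⇒⌈log₂n⌉≤k (⌈log₂ n ⌉ + 1) (begin
  n + 1                    ≤⟨ +-monoʳ-≤ n 1≤n ⟩
  n + n                    ≤⟨ +-mono-≤ (n≤2^⌈log₂n⌉ n) (n≤2^⌈log₂n⌉ n) ⟩
  2^ℓ + 2^ℓ                ≡⟨ cong (2^ℓ +_) (+-identityʳ 2^ℓ) ⟨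
  2 ^ suc ⌈log₂ n ⌉        ≡⟨ cong (2 ^_) (+-comm 1 ⌈log₂ n ⌉) ⟩
  2 ^ (⌈log₂ n ⌉ + 1)      ∎)
  where
  open ≤-Reasoning
  2^ℓ : ℕ
  2^ℓ = 2 ^ ⌈log₂ n ⌉

m≤ceilDiv*n : ∀ m n → m ≤ ceilDiv m (suc n) * suc n
m≤ceilDiv*n m n = +-cancelʳ-≤ n m (q * suc n) (begin
  m + n                   ≡⟨ cong (_∸ 1) (+-suc m n) ⟨
  m′                      ≡⟨ m≡m%n+[m/n]*n m′ (suc n) ⟩
  m′ % suc n + q * suc n  ≤⟨ +-monoˡ-≤ (q * suc n) (<⇒≤pred (m%n<n m′ (suc n))) ⟩
  n + q * suc n           ≡⟨ +-comm n (q * suc n) ⟩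
  q * suc n + n           ∎)
  where
  open ≤-Reasoning
  m′ q : ℕ
  m′ = m + suc n ∸ 1
  q = m′ / suc n

ceilDiv*n≤m+n : ∀ m n → ceilDiv m (suc n) * suc n ≤ m + suc n
ceilDiv*n≤m+n m n = begin
  (m + suc n ∸ 1) / suc n * suc n   ≤⟨ m/n*n≤m (m + suc n ∸ 1) (suc n) ⟩
  m + suc n ∸ 1                     ≤⟨ m∸n≤m (m + suc n) 1 ⟩
  m + suc n                         ∎
  where open ≤-Reasoning

-- Minimal numbers of tests

LowerBound : (K N T : ℕ) → Set
LowerBound K N T = ∀ T′ → N ≤ E T′ K → T ≤ T′

E<N⇒LowerBound[T+1] : ∀ {K N T} → E T K < N → LowerBound K N (T + 1)
E<N⇒LowerBound[T+1] {K} {N} {T} E<N T′ N≤E =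
  subst (_≤ T′) (+-comm 1 T) (E-cancelˡ-< K (<-≤-trans E<N N≤E))

2^[j*K]≤1+E[K*2^j,K] : ∀ j K → 2 ^ (j * K) ≤ suc (E (K * 2 ^ j) K)
2^[j*K]≤1+E[K*2^j,K] j K = begin
  2 ^ (j * K)            ≡⟨ ^-*-assoc 2 j K ⟨
  (2 ^ j) ^ K            ≤⟨ ^-monoˡ-≤ K (n≤1+n (2 ^ j)) ⟩
  suc (2 ^ j) ^ K        ≤⟨ [1+m]^k≤1+E[k*m,k] K (2 ^ j) ⟩
  suc (E (K * 2 ^ j) K)  ∎
  where open ≤-Reasoning

⌈log₂[N+1]⌉-LowerBound : ∀ K N → LowerBound K N ⌈log₂ (N + 1) ⌉
⌈log₂[N+1]⌉-LowerBound K N T N≤E =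
  n≤2^k⇒⌈log₂n⌉≤k T (subst (_≤ 2 ^ T) (+-comm 1 N) (<-≤-trans (s≤s N≤E) (E<2^T T K)))

isMinTests-log : ∀ {K N} → ⌈log₂ (N + 1) ⌉ ≤ K → IsMinTests K N ⌈log₂ (N + 1) ⌉
isMinTests-log {K} {N} ℓ≤K = N≤E , ⌈log₂[N+1]⌉-LowerBound K N
  where
  ℓ : ℕ
  ℓ = ⌈log₂ (N + 1) ⌉
  N≤E : N ≤ E ℓ K
  N≤E = begin
    N          ≤⟨ s≤s⁻¹ (subst₂ _≤_ (+-comm N 1) (sym (1+E[T,T]≡2^T ℓ)) (n≤2^⌈log₂n⌉ (N + 1))) ⟩
    E ℓ ℓ      ≤⟨ E-monoʳ-≤ ℓ ℓ≤K ⟩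
    E ℓ K      ∎
    where open ≤-Reasoning

isMinTests-N≡1 : ∀ k → IsMinTests (suc k) 1 1
isMinTests-N≡1 k = isMinTests-log (s≤s z≤n)

isMinTests-K≡1 : ∀ N → IsMinTests 1 N N
isMinTests-K≡1 N = ≤-reflexive (sym (nC1≡n N)) , λ T N≤E → subst (N ≤_) (nC1≡n T) N≤E

-- Correctness and cost of Algorithm 1

InnerResult : (N T k budget : ℕ) → ℕ × ℕ × ℕ → Set
InnerResult N T k budget (term , Eₖ , c) =
  c ≤ budget × (N ≤ Eₖ → N ≤ E T k) × (Eₖ < N → Eₖ ≡ E T k × term ≡ T C k)

-- The bound j + r ≤ T matters: at i = T + 1 truncated subtraction turns the factor
-- T − i + 1 into 1 instead of 0.
inner-correct : ∀ N T r j c → j + r ≤ T →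
  InnerResult N T (j + r) (c + r * 8) (inner r (suc j) T (T C j) (E T j) N c)
inner-correct N T zero    j c _ rewrite +-identityʳ j | +-identityʳ c =
  ≤-refl , (λ N≤E → N≤E) , (λ _ → refl , refl)
inner-correct N T (suc r) j c j+1+r≤T
  rewrite nC[1+k]-from-nCk (≤-trans (m<m+n j {suc r} z<s) j+1+r≤T)
  with N ≤ᵇ E T (suc j) | ≤ᵇ-reflects-≤ N (E T (suc j))
... | true  | ofʸ N≤E =
    +-monoʳ-≤ c (m≤m+n 8 (r * 8))
  , (λ _ → ≤-trans N≤E (E-monoʳ-≤ T 1+j≤j+1+r))
  , (λ E<N → ⊥-elim (<⇒≱ E<N N≤E))
  where
  1+j≤j+1+r : suc j ≤ j + suc r
  1+j≤j+1+r = subst (suc j ≤_) (sym (+-suc j r)) (s≤s (m≤m+n j r))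
... | false | ofⁿ _ =
  subst₂ (λ k b → InnerResult N T k b (inner r (suc (suc j)) T (T C suc j) (E T (suc j)) N (c + 8)))
         (sym (+-suc j r)) (+-assoc c 8 (r * 8))
         (inner-correct N T r (suc j) (c + 8) (subst (_≤ T) (+-suc j r) j+1+r≤T))

record Bisection (j L M R : ℕ) : Set where
  constructor bisected
  field
    L≤M         : L ≤ M
    M<R         : M < R
    left-width  : M ∸ L < 2 ^ j
    right-width : R ∸ suc M < 2 ^ j

[L+[L+D]]/2≡L+D/2 : ∀ L D → (L + (L + D)) / 2 ≡ L + D / 2
[L+[L+D]]/2≡L+D/2 L D = begin
  (L + (L + D)) / 2      ≡⟨ cong (_/ 2) (regroup L D) ⟩
  (L * 2 + D) / 2        ≡⟨ +-distrib-/-∣ˡ D (n∣m*n L) ⟩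
  L * 2 / 2 + D / 2      ≡⟨ cong (_+ D / 2) (m*n/n≡m L 2) ⟩
  L + D / 2              ∎
  where
  open ≡-Reasoning
  regroup : ∀ L D → L + (L + D) ≡ L * 2 + D
  regroup = solve-∀

bisection-by-width : ∀ j L D → 0 < D → D < 2 ^ suc j → Bisection j L (L + D / 2) (L + D)
bisection-by-width j L D 0<D D<2^[1+j] = record
  { L≤M         = m≤m+n L H
  ; M<R         = +-monoʳ-< L (m/n<m D 2 {{>-nonZero 0<D}} (s≤s (s≤s z≤n)))
  ; left-width  = subst (_< 2 ^ j) (sym (m+n∸m≡n L H)) H<2^j
  ; right-width = subst (_< 2 ^ j) (sym right-part) (≤-<-trans (m≤n+o⇒m∸n≤o D (suc H) D≤1+H+H) H<2^j)
  }
  where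
  H : ℕ
  H = D / 2
  H<2^j : H < 2 ^ j
  H<2^j = m<n*o⇒m/o<n (subst (D <_) (*-comm 2 (2 ^ j)) D<2^[1+j])
  D≤1+H+H : D ≤ suc H + H
  D≤1+H+H = begin
    D                  ≡⟨ m≡m%n+[m/n]*n D 2 ⟩
    D % 2 + H * 2      ≤⟨ +-monoˡ-≤ (H * 2) (<⇒≤pred (m%n<n D 2)) ⟩
    1 + H * 2          ≡⟨ cong suc (trans (*-comm H 2) (cong (H +_) (+-identityʳ H))) ⟩
    suc H + H          ∎
    where open ≤-Reasoning
  right-part : L + D ∸ suc (L + H) ≡ D ∸ suc H
  right-part = trans (cong (L + D ∸_) (sym (+-suc L H))) ([m+n]∸[m+o]≡n∸o L D (suc H))

bisection : ∀ j {L R} → L < R → R ∸ L < 2 ^ suc j → Bisection j L ((L + R) / 2) R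
bisection j {L} {R} L<R width =
  subst (λ R → Bisection j L ((L + R) / 2) R) (m+[n∸m]≡n (<⇒≤ L<R))
    (subst (λ M → Bisection j L M (L + (R ∸ L))) (sym ([L+[L+D]]/2≡L+D/2 L (R ∸ L)))
      (bisection-by-width j L (R ∸ L) (m<n⇒0<n∸m L<R) width))

OptimalWithin : (K N budget : ℕ) → ℕ × ℕ → Set
OptimalWithin K N budget (T , c) = IsMinTests K N T × c ≤ budget

OptimalWithin-mono : ∀ {K N b b′} → b ≤ b′ → ∀ {x} → OptimalWithin K N b x → OptimalWithin K N b′ x
OptimalWithin-mono b≤b′ (optimal , c≤b) = optimal , ≤-trans c≤b b≤b′

linear-correct : ∀ {k N} f d T {E′ B} c → E′ ≡ E T (suc k) → B ≡ T C suc k →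
  suc k ≤ T → d < f → N ≤ E (T + d) (suc k) → LowerBound (suc k) N T →
  Any (OptimalWithin (suc k) N (c + d * 12 + 1)) (linear f (suc k) N E′ B T c)
linear-correct {k} {N} (suc f) d T c refl refl K≤T d<f N≤E[T+d] lower
  with E T (suc k) <ᵇ N | <ᵇ-reflects-< (E T (suc k)) N
... | false | ofⁿ E≮N = just ((≮⇒≥ E≮N , lower) , +-monoˡ-≤ 1 (m≤m+n c (d * 12)))
... | true  | ofʸ E<N with d
...   | zero    = ⊥-elim (<⇒≱ E<N (subst (λ T′ → N ≤ E T′ (suc k)) (+-identityʳ T) N≤E[T+d]))
...   | suc d′  =
  Any.map (OptimalWithin-mono (≤-reflexive (cong (_+ 1) (+-assoc c 12 (d′ * 12)))))
    (linear-correct f d′ (T + 1) (c + 12)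
      (E[T+1]-from-E[T] T (suc k)) ([n+1]C[1+k]-from-nC[1+k] K≤T)
      (≤-trans K≤T (m≤m+n T 1)) (s≤s⁻¹ d<f)
      (subst (λ T′ → N ≤ E T′ (suc k)) (sym (+-assoc T 1 d′)) N≤E[T+d])
      (E<N⇒LowerBound[T+1] E<N))

module BinarySearch (k N : ℕ) where

  K : ℕ
  K = suc k

  ValidCache : (Ec Bc Tc : ℕ) → Set
  ValidCache Ec Bc Tc = Ec ≡ E Tc K × Bc ≡ Tc C K × E Tc K < N × K ≤ Tc

  -- While L = 1 the cache still holds the placeholder (0, 1, K), which does not describe
  -- E(K, K); it is never returned, because E(K, K) < N forces some probe to move L.
  CacheInvariant : (L Ec Bc Tc : ℕ) → Set
  CacheInvariant L Ec Bc Tc = L ≡ 1 ⊎ (Tc + K ≡ K * L × ValidCache Ec Bc Tc)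

  Bracketed : ℕ → ℕ × ℕ × ℕ × ℕ → Set
  Bracketed budget (Ec , Bc , Tc , c) = ValidCache Ec Bc Tc × N ≤ E (Tc + K) K × c ≤ budget

  Bracketed-mono : ∀ {b b′} → b ≤ b′ → ∀ {x} → Bracketed b x → Bracketed b′ x
  Bracketed-mono b≤b′ (valid , N≤E , c≤b) = valid , N≤E , ≤-trans c≤b b≤b′

  iteration-cost : ∀ {c c₁ a} x → c₁ ≤ c + 7 + K * 8 → a ≤ 5 → c₁ + a + x + 1 ≤ c + (20 * K + x) + 1
  iteration-cost {c} {c₁} {a} x c₁≤ a≤5 = begin
    c₁ + a + x + 1                          ≤⟨ +-monoˡ-≤ 1 (+-monoˡ-≤ x (+-mono-≤ c₁≤ a≤5)) ⟩
    c + 7 + K * 8 + 5 + x + 1               ≤⟨ m≤m+n _ (12 * k) ⟩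
    c + 7 + K * 8 + 5 + x + 1 + 12 * k      ≡⟨ regroup c k x ⟩
    c + (20 * K + x) + 1                    ∎
    where
    open ≤-Reasoning
    regroup : ∀ c k x → c + 7 + suc k * 8 + 5 + x + 1 + 12 * k ≡ c + (20 * suc k + x) + 1
    regroup = solve-∀

  K≤K*M : ∀ {M} → 1 ≤ M → K ≤ K * M
  K≤K*M {M} 1≤M = subst (_≤ K * M) (*-identityʳ K) (*-monoʳ-≤ K 1≤M)

  module _ (E[K*1,K]<N : E (K * 1) K < N) where

    bsearch-stop : ∀ {L R Ec Bc Tc} c → CacheInvariant L Ec Bc Tc → L ≡ R → N ≤ E (K * R) K →
      Bracketed (c + 1) (Ec , Bc , Tc , c + 1)
    bsearch-stop c (inj₁ refl)                refl N≤E = ⊥-elim (<⇒≱ E[K*1,K]<N N≤E)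
    bsearch-stop c (inj₂ (Tc+K≡K*L , valid)) refl N≤E =
      valid , subst (λ T → N ≤ E T K) (sym Tc+K≡K*L) N≤E , ≤-refl

    CacheInvariant-probe : ∀ {M term Eₘ} → 1 ≤ M → Eₘ < N → Eₘ ≡ E (K * M) K × term ≡ (K * M) C K →
      CacheInvariant (M + 1) Eₘ term (K * M)
    CacheInvariant-probe {M} 1≤M Eₘ<N (Eₘ≡E , term≡C) =
      inj₂ (K*M+K≡K*[M+1] , Eₘ≡E , term≡C , subst (_< N) Eₘ≡E Eₘ<N , K≤K*M 1≤M)
      where
      K*M+K≡K*[M+1] : K * M + K ≡ K * (M + 1)
      K*M+K≡K*[M+1] = begin
        K * M + K          ≡⟨ cong (K * M +_) (*-identityʳ K) ⟨
        K * M + K * 1      ≡⟨ *-distribˡ-+ K M 1 ⟨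
        K * (M + 1)        ∎
        where open ≡-Reasoning

    bsearch-correct : ∀ f j L R Ec Bc Tc c → 1 ≤ L → L ≤ R → R ∸ L < 2 ^ j → j < f →
      N ≤ E (K * R) K → CacheInvariant L Ec Bc Tc →
      Any (Bracketed (c + j * (20 * K) + 1)) (bsearch f K N L R Ec Bc Tc c)
    bsearch-correct (suc f) j L R Ec Bc Tc c 1≤L L≤R width j<f N≤E[K*R] cache
      with L <ᵇ R | <ᵇ-reflects-< L R
    ... | false | ofⁿ L≮R =
      just (Bracketed-mono (+-monoˡ-≤ 1 (m≤m+n c _))
              (bsearch-stop c cache (≤-antisym L≤R (≮⇒≥ L≮R)) N≤E[K*R]))
    ... | true  | ofʸ L<R with j
    ...   | zero   = ⊥-elim (<⇒≱ (m<n⇒0<n∸m L<R) (s≤s⁻¹ width))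
    ...   | suc j′ with bisection j′ L<R width
    ...   | bisected L≤M M<R left-width right-width
      with inner K 1 (K * ((L + R) / 2)) 1 0 N (c + 7)
         | inner-correct N (K * ((L + R) / 2)) K 0 (c + 7) (K≤K*M (≤-trans 1≤L L≤M))
    ...   | term , Eₘ , c₁ | c₁≤ , N≤Eₘ⇒N≤E , Eₘ<N⇒exact with N ≤ᵇ Eₘ | ≤ᵇ-reflects-≤ N Eₘ
    ...   | true  | ofʸ N≤Eₘ =
      Any.map (Bracketed-mono (iteration-cost (j′ * (20 * K)) c₁≤ (s≤s (s≤s z≤n))))
        (bsearch-correct f j′ L ((L + R) / 2) Ec Bc Tc (c₁ + 2) 1≤L L≤M left-width (s≤s⁻¹ j<f)
          (N≤Eₘ⇒N≤E N≤Eₘ) cache)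
    ...   | false | ofⁿ N≰Eₘ =
      Any.map (Bracketed-mono (iteration-cost (j′ * (20 * K)) c₁≤ ≤-refl))
        (bsearch-correct f j′ ((L + R) / 2 + 1) R Eₘ term (K * ((L + R) / 2)) (c₁ + 5) (m≤n+m 1 _)
          (subst (_≤ R) (+-comm 1 _) M<R) (subst (λ L′ → R ∸ L′ < 2 ^ j′) (+-comm 1 _) right-width)
          (s≤s⁻¹ j<f) N≤E[K*R]
          (CacheInvariant-probe (≤-trans 1≤L L≤M) (≰⇒> N≰Eₘ) (Eₘ<N⇒exact (≰⇒> N≰Eₘ))))

sufficientFuel : ℕ → ℕ → ℕ
sufficientFuel K N = suc (ceilDiv ⌈log₂ (N + 1) ⌉ K + K)

small-cost : ∀ ℓ → 3 ≤ 74 * (ℓ + 1)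
small-cost ℓ = ≤-trans (s≤s (s≤s (s≤s z≤n))) (*-monoʳ-≤ 74 (m≤n+m 1 ℓ))

a+b*t≤[a+b]*[ℓ+1] : ∀ a b {t ℓ} → t ≤ ℓ + 1 → a + b * t ≤ (a + b) * (ℓ + 1)
a+b*t≤[a+b]*[ℓ+1] a b {t} {ℓ} t≤ℓ+1 = begin
  a + b * t                    ≤⟨ +-mono-≤ (m≤m*n a (ℓ + 1) {{>-nonZero (m≤n+m 1 ℓ)}}) (*-monoʳ-≤ b t≤ℓ+1) ⟩
  a * (ℓ + 1) + b * (ℓ + 1)    ≡⟨ *-distribʳ-+ (ℓ + 1) a b ⟨
  (a + b) * (ℓ + 1)            ∎
  where open ≤-Reasoning

log-cost : ∀ {t ℓ} → t ≤ ℓ + 1 → 3 + (t + 2) + 1 ≤ 74 * (ℓ + 1)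
log-cost {t} {ℓ} t≤ℓ+1 = begin
  3 + (t + 2) + 1              ≡⟨ regroup t ⟩
  6 + 1 * t                    ≤⟨ a+b*t≤[a+b]*[ℓ+1] 6 1 t≤ℓ+1 ⟩
  7 * (ℓ + 1)                  ≤⟨ *-monoˡ-≤ (ℓ + 1) (m≤m+n 7 67) ⟩
  74 * (ℓ + 1)                 ∎
  where
  open ≤-Reasoning
  regroup : ∀ t → 3 + (t + 2) + 1 ≡ 6 + 1 * t
  regroup = solve-∀

search-cost : ∀ {t K j ℓ c₂} → K ≤ t → j * K ≤ t + K → t ≤ ℓ + 1 →
  c₂ ≤ 3 + (t + 2) + 1 + 10 + j * (20 * K) + 1 → c₂ + 3 + K * 12 + 1 ≤ 74 * (ℓ + 1)
search-cost {t} {K} {j} {ℓ} {c₂} K≤t j*K≤t+K t≤ℓ+1 c₂≤ = begin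
  c₂ + 3 + K * 12 + 1
    ≤⟨ +-monoˡ-≤ 1 (+-monoˡ-≤ (K * 12) (+-monoˡ-≤ 3 c₂≤)) ⟩
  3 + (t + 2) + 1 + 10 + j * (20 * K) + 1 + 3 + K * 12 + 1
    ≡⟨ regroup t j K ⟩
  21 + t + 20 * (j * K) + 12 * K
    ≤⟨ +-mono-≤ (+-monoʳ-≤ (21 + t) (*-monoʳ-≤ 20 (≤-trans j*K≤t+K (+-monoʳ-≤ t K≤t)))) (*-monoʳ-≤ 12 K≤t) ⟩
  21 + t + 20 * (t + t) + 12 * t
    ≡⟨ collect t ⟩
  21 + 53 * t
    ≤⟨ a+b*t≤[a+b]*[ℓ+1] 21 53 t≤ℓ+1 ⟩
  74 * (ℓ + 1) ∎
  where
  open ≤-Reasoning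
  regroup : ∀ t j K → 3 + (t + 2) + 1 + 10 + j * (20 * K) + 1 + 3 + K * 12 + 1 ≡ 21 + t + 20 * (j * K) + 12 * K
  regroup = solve-∀
  collect : ∀ t → 21 + t + 20 * (t + t) + 12 * t ≡ 21 + 53 * t
  collect = solve-∀

search-phase-start : ∀ k N → ¬ (⌈log₂ (N + 1) ⌉ ≤ suc (suc k)) →
  Any (BinarySearch.Bracketed (suc k) N
        (3 + (⌈log₂ (N + 1) ⌉ + 2) + 1 + 10 + ceilDiv ⌈log₂ (N + 1) ⌉ (suc (suc k)) * (20 * suc (suc k)) + 1))
      (bsearch (sufficientFuel (suc (suc k)) N) (suc (suc k)) N
               1 (2 ^ ceilDiv ⌈log₂ (N + 1) ⌉ (suc (suc k))) 0 1 (suc (suc k)) (3 + (⌈log₂ (N + 1) ⌉ + 2) + 1 + 10))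
search-phase-start k N ℓ≰K =
  BinarySearch.bsearch-correct (suc k) N E[K,K]<N (sufficientFuel K N) j 1 (2 ^ j) 0 1 K (3 + (ℓ + 2) + 1 + 10)
    ≤-refl (m^n>0 2 j) (m<n+o⇒m∸n<o (2 ^ j) 1 {{m^n≢0 2 j}} (n<1+n (2 ^ j))) (s≤s (m≤m+n j K))
    N≤E[K*2^j,K] (inj₁ refl)
  where
  K j ℓ : ℕ
  K = suc (suc k)
  ℓ = ⌈log₂ (N + 1) ⌉
  j = ceilDiv ℓ K
  E[K,K]<N : E (K * 1) K < N
  E[K,K]<N = ≰⇒> λ N≤E →
    ℓ≰K (subst (ℓ ≤_) (*-identityʳ K) (⌈log₂[N+1]⌉-LowerBound K N (K * 1) N≤E))
  N≤E[K*2^j,K] : N ≤ E (K * 2 ^ j) K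
  N≤E[K*2^j,K] = s≤s⁻¹ (begin
    suc N                 ≡⟨ +-comm 1 N ⟩
    N + 1                 ≤⟨ n≤2^⌈log₂n⌉ (N + 1) ⟩
    2 ^ ℓ                 ≤⟨ ^-monoʳ-≤ 2 (m≤ceilDiv*n ℓ (suc k)) ⟩
    2 ^ (j * K)           ≤⟨ 2^[j*K]≤1+E[K*2^j,K] j K ⟩
    suc (E (K * 2 ^ j) K) ∎)
    where open ≤-Reasoning

algorithm-correct : ∀ k N → 1 ≤ N →
  Any (OptimalWithin (suc k) N (74 * (⌈log₂ N ⌉ + 1))) (algorithm (sufficientFuel (suc k) N) (suc k) N)
algorithm-correct k N 1≤N with N ≤ᵇ 1 | ≤ᵇ-reflects-≤ N 1
... | true  | ofʸ N≤1 =
  just (subst (λ n → IsMinTests (suc k) n n) (≤-antisym 1≤N N≤1) (isMinTests-N≡1 k) , small-cost ⌈log₂ N ⌉)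
algorithm-correct zero    N 1≤N | false | _ = just (isMinTests-K≡1 N , small-cost ⌈log₂ N ⌉)
algorithm-correct (suc k) N 1≤N | false | _
  with ⌈log₂ (N + 1) ⌉ ≤ᵇ suc (suc k) | ≤ᵇ-reflects-≤ ⌈log₂ (N + 1) ⌉ (suc (suc k))
... | true  | ofʸ ℓ≤K =
  just (isMinTests-log ℓ≤K , log-cost {ℓ = ⌈log₂ N ⌉} (⌈log₂[n+1]⌉≤⌈log₂n⌉+1 1≤N))
... | false | ofⁿ ℓ≰K
  with bsearch (sufficientFuel (suc (suc k)) N) (suc (suc k)) N
                1 (2 ^ ceilDiv ⌈log₂ (N + 1) ⌉ (suc (suc k))) 0 1 (suc (suc k)) (3 + (⌈log₂ (N + 1) ⌉ + 2) + 1 + 10)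
     | search-phase-start k N ℓ≰K
... | just (Ec , Bc , Tc , c₂) | just ((Ec≡E , Bc≡C , E<N , K≤Tc) , N≤E[Tc+K] , c₂≤) =
  Any.map (OptimalWithin-mono cost)
    (linear-correct (sufficientFuel K N) K Tc (c₂ + 3) Ec≡E Bc≡C K≤Tc (s≤s (m≤n+m K j)) N≤E[Tc+K] lower)
  where
  K j ℓ : ℕ
  K = suc (suc k)
  ℓ = ⌈log₂ (N + 1) ⌉
  j = ceilDiv ℓ K
  lower : LowerBound K N Tc
  lower T N≤E = ≤-trans (m≤m+n Tc 1) (E<N⇒LowerBound[T+1] E<N T N≤E)
  cost : c₂ + 3 + K * 12 + 1 ≤ 74 * (⌈log₂ N ⌉ + 1)
  cost = search-cost {ℓ} {K} {j} {⌈log₂ N ⌉} (≤-trans (n≤1+n K) (≰⇒> ℓ≰K)) (ceilDiv*n≤m+n ℓ (suc k))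
                                              (⌈log₂[n+1]⌉≤⌈log₂n⌉+1 1≤N) c₂≤

Any⇒≡just : ∀ {A B : Set} {P : A × B → Set} {m : Maybe (A × B)} →
  Any P m → ∃[ a ] ∃[ b ] (m ≡ just (a , b)) × P (a , b)
Any⇒≡just (just p) = _ , _ , refl , p

theorem1 : ∃[ C ] (∀ K N → 1 ≤ K → 1 ≤ N →
               ∃[ fuel ] ∃[ T ] ∃[ cost ]
                 (algorithm fuel K N ≡ just (T , cost))
                 × IsMinTests K N T
                 × (cost ≤ C * (⌈log₂ N ⌉ + 1)))
theorem1 = 74 , λ where
  zero    _ () _
  (suc k) N _  1≤N → sufficientFuel (suc k) N , Any⇒≡just (algorithm-correct k N 1≤N)
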